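{- If $k\ge 9$ is an odd integer with $3\nmid k$, then $T_2(k,2,1)$ is a bicirculant.
   Context: $T_2(k,r,s)$ is the graph with vertex set $\{u_i,v_i,w_i: i\in\mathbb{Z}_{2k}\}$ and edges $w_iw_{i+k}$, $u_iv_i$, $u_iw_i$, $u_iw_{i+r}$, $v_iv_{i+s}$ ($i\in\mathbb{Z}_{2k}$). A connected graph is a bicirculant if it admits a cyclic group of automorphisms with exactly two orbits on vertices, both of equal size larger than $1$. -}

module Defs where

open import Data.Nat using (ℕ; zero; suc; _+_; _*_; _<_)
open import Data.Fin using (Fin; toℕ)
open import Data.Product using (Σ; ∃; _×_; _,_)
open import Data.Sum using (_⊎_)
open import Relation.Binary.PropositionalEquality using (_≡_)
open import Relation.Nullary using (¬_)
open import Function.Bundles using (_⇔_)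

-- a ≡ b (mod n), stated without division
_≡_[mod_] : ℕ → ℕ → ℕ → Set
a ≡ b [mod n ] = ∃ (λ q → a + q * n ≡ b) ⊎ ∃ (λ q → b + q * n ≡ a)

record Graph : Set₁ where
  field
    Vertex : Set
    Adj    : Vertex → Vertex → Set

open Graph public

data Reach (G : Graph) : Vertex G → Vertex G → Set where
  here : ∀ {x} → Reach G x x
  step : ∀ {x y z} → Adj G x y → Reach G y z → Reach G x z

Connected : Graph → Set
Connected G = ∀ (x y : Vertex G) → Reach G x y

record Automorphism (G : Graph) : Set where
  field
    fun     : Vertex G → Vertex G
    inv     : Vertex G → Vertex G
    inv-r   : ∀ x → fun (inv x) ≡ x
    inv-l   : ∀ x → inv (fun x) ≡ x
    adj-iff : ∀ x y → Adj G x y ⇔ Adj G (fun x) (fun y)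

iterate : {A : Set} → (A → A) → ℕ → A → A
iterate f zero    x = x
iterate f (suc m) x = f (iterate f m x)

-- the orbit of x under the cyclic group ⟨f⟩ has exactly n elements
-- (n is the least positive period of x under f)
OrbitSize : {A : Set} → (A → A) → A → ℕ → Set
OrbitSize f x n = (0 < n) × (iterate f n x ≡ x)
                  × (∀ j → 0 < j → j < n → ¬ (iterate f j x ≡ x))

InOrbit : {A : Set} → (A → A) → A → A → Set
InOrbit f x y = ∃ λ m → iterate f m x ≡ y

Bicirculant : Graph → Set
Bicirculant G =
  Connected G ×
  Σ (Automorphism G) λ σ → let f = Automorphism.fun σ in
  Σ ℕ λ n → Σ (Vertex G) λ a → Σ (Vertex G) λ b →
    (1 < n) × OrbitSize f a n × OrbitSize f b n
    × ¬ InOrbit f a b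
    × (∀ x → InOrbit f a x ⊎ InOrbit f b x)

data Kind : Set where
  u v w : Kind

TVertex : ℕ → Set
TVertex k = Kind × Fin (2 * k)

-- directed generating edges (indices taken modulo 2k)
data TEdge (k r s : ℕ) : TVertex k → TVertex k → Set where
  ww  : ∀ {i j} → toℕ j ≡ toℕ i + k [mod 2 * k ] → TEdge k r s (w , i) (w , j)
  uv  : ∀ {i}   → TEdge k r s (u , i) (v , i)
  uw  : ∀ {i}   → TEdge k r s (u , i) (w , i)
  uwr : ∀ {i j} → toℕ j ≡ toℕ i + r [mod 2 * k ] → TEdge k r s (u , i) (w , j)
  vv  : ∀ {i j} → toℕ j ≡ toℕ i + s [mod 2 * k ] → TEdge k r s (v , i) (v , j)

T₂ : ℕ → ℕ → ℕ → Graph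
T₂ k r s = record
  { Vertex = TVertex k
  ; Adj    = λ x y → TEdge k r s x y ⊎ TEdge k r s y x
  }

module Submission where

-- The automorphism σ sends a vertex of kind t at
-- position i to a vertex whose kind and position shift depend only on t and
-- on the parity of i (table `move`); since 2k is even the parity of a
-- position is well defined.  One checks, family by family, that σ maps edges
-- to edges, and, kind by kind, that σ³ is the translation by k + 3.
-- As k + 3 is even, σ^(3k) = id, so σ is an automorphism.  The parity of the
-- position, flipped on kinds v and w, is σ-invariant and separates the
-- orbits of u₀ and v₀.  Each of these orbits meets every kind, and because
-- some m satisfies m(k + 3) ≡ 2 (mod 2k) (this is where 3 ∤ k enters),
-- σ^(3m) translates by 2, so each orbit fills its whole invariant class.
-- Finally σ changes the kind of every vertex while σ³ does not, and a
-- translation by q(k + 3) with 0 < q < k is not trivial, so every orbit has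
-- exactly 3k elements.

open import Defs
open import Data.Nat using (ℕ; _≤_)
open import Data.Nat.Divisibility using (_∣_)
open import Relation.Nullary using (¬_)

open import Data.Nat using (zero; suc; _+_; _*_; _<_; NonZero; ≢-nonZero; >-nonZero⁻¹; pred; parity; z≤n; s≤s)
open import Data.Nat.Properties
  using (+-assoc; +-comm; +-identityʳ; *-comm; *-assoc; suc-pred; m*n≢0; <⇒≱; <-≤-trans; *-cancelʳ-<; *-monoˡ-≤)
  renaming (+-cancelˡ-≡ to ℕ-+-cancelˡ-≡)
open import Data.Nat.DivMod
  using (_%_; _/_; _mod_; _divMod_; result; m≡m%n+[m/n]*n; [m+kn]%n≡m%n;
         %-distribˡ-+; %-distribˡ-*; m%n%n≡m%n; m<n⇒m%n≡m)
open import Data.Nat.Divisibility using (divides; m%n≡0⇒n∣m; n∣m⇒m%n≡0; ∣n⇒∣m*n; *-cancelˡ-∣; ∣⇒≤)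
open import Data.Nat.Tactic.RingSolver using (solve-∀)
open import Data.Parity.Base as ℙ using (Parity; 0ℙ; 1ℙ; _⁻¹)
open import Data.Parity.Properties using (+-homo-+; *-homo-*; p+p≡0ℙ; suc-homo-⁻¹)
  renaming (+-identityʳ to ℙ-+-identityʳ; *-zeroʳ to ℙ-*-zeroʳ; +-cancelˡ-≡ to ℙ-+-cancelˡ-≡)
open import Data.Fin as Fin using (Fin; toℕ)
open import Data.Fin.Properties using (toℕ-fromℕ<; toℕ-injective; toℕ<n)
open import Data.Product using (∃-syntax; _×_; _,_; proj₁; proj₂)
open import Data.Sum using (_⊎_; inj₁; inj₂; swap)
open import Data.Empty using (⊥-elim)
open import Relation.Binary.PropositionalEquality
  using (_≡_; _≢_; refl; sym; trans; cong; subst; subst₂; module ≡-Reasoning)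
open import Function.Bundles using (mk⇔)

iterate-+ : ∀ {A : Set} (f : A → A) a b x → iterate f (a + b) x ≡ iterate f a (iterate f b x)
iterate-+ f zero    b x = refl
iterate-+ f (suc a) b x = cong f (iterate-+ f a b x)

iterate-commute : ∀ {A : Set} (f : A → A) N x → iterate f N (f x) ≡ f (iterate f N x)
iterate-commute f N x = trans (sym (iterate-+ f N 1 x)) (cong (λ j → iterate f j x) (+-comm N 1))

iterate-invariant : ∀ {A B : Set} (f : A → A) (g : A → B) →
                    (∀ x → g (f x) ≡ g x) → ∀ j x → g (iterate f j x) ≡ g x
iterate-invariant f g inv zero    x = refl
iterate-invariant f g inv (suc j) x = trans (inv (iterate f j x)) (iterate-invariant f g inv j x)

orbit-closed : ∀ {A : Set} {f : A → A} {b x} → InOrbit f b x → ∀ j → InOrbit f b (iterate f j x)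
orbit-closed {f = f} {b} (m , refl) j = j + m , iterate-+ f j m b

_++ʳ_ : ∀ {G x y z} → Reach G x y → Reach G y z → Reach G x z
here       ++ʳ q = q
step a p   ++ʳ q = step a (p ++ʳ q)

connected-from-root : ∀ {G} → (∀ {x y} → Adj G x y → Adj G y x) →
                      (r : Vertex G) → (∀ x → Reach G r x) → Connected G
connected-from-root {G} sym-adj r reach x y = reverse (reach x) ++ʳ reach y
  where
  reverse : ∀ {x y} → Reach G x y → Reach G y x
  reverse here       = here
  reverse (step a p) = reverse p ++ʳ step (sym-adj a) here

iterate-preserves : ∀ {G} (f : Vertex G → Vertex G) →
                    (∀ {x y} → Adj G x y → Adj G (f x) (f y)) →
                    ∀ j {x y} → Adj G x y → Adj G (iterate f j x) (iterate f j y)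
iterate-preserves f pres zero    a = a
iterate-preserves {G} f pres (suc j) a = pres (iterate-preserves {G} f pres j a)

-- An adjacency-preserving map some positive power of which is the identity
-- is an automorphism: its inverse is the preceding power.
periodic-automorphism : ∀ {G} (f : Vertex G → Vertex G) N →
                        (∀ {x y} → Adj G x y → Adj G (f x) (f y)) →
                        (∀ x → iterate f (suc N) x ≡ x) → Automorphism G
periodic-automorphism {G} f N pres period = record
  { fun     = f
  ; inv     = iterate f N
  ; inv-r   = period
  ; inv-l   = inv-l
  ; adj-iff = λ x y → mk⇔ pres
      (λ a → subst₂ (Adj G) (inv-l x) (inv-l y) (iterate-preserves {G} f pres N a))
  }
  where
  inv-l : ∀ x → iterate f N (f x) ≡ x
  inv-l x = trans (iterate-commute f N x) (period x)

-- Residues modulo a positive n.  A congruence a ≡ b [mod n] is handled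
-- through the equivalent equation a % n ≡ b % n, which composes freely.

module Residues (n : ℕ) .{{_ : NonZero n}} where

  ≡mod⇒% : ∀ {a b} → a ≡ b [mod n ] → a % n ≡ b % n
  ≡mod⇒% {a} (inj₁ (q , a+qn≡b)) = trans (sym ([m+kn]%n≡m%n a q n)) (cong (_% n) a+qn≡b)
  ≡mod⇒% {b = b} (inj₂ (q , b+qn≡a)) = trans (cong (_% n) (sym b+qn≡a)) ([m+kn]%n≡m%n b q n)

  %-≡mod : ∀ x → (x % n) ≡ x [mod n ]
  %-≡mod x = inj₁ (x / n , sym (m≡m%n+[m/n]*n x n))

  +-congʳ-% : ∀ {a b} c → a % n ≡ b % n → (a + c) % n ≡ (b + c) % n
  +-congʳ-% {a} {b} c a≈b = begin
    (a + c) % n             ≡⟨ %-distribˡ-+ a c n ⟩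
    (a % n + c % n) % n     ≡⟨ cong (λ x → (x + c % n) % n) a≈b ⟩
    (b % n + c % n) % n     ≡⟨ %-distribˡ-+ b c n ⟨
    (b + c) % n             ∎
    where open ≡-Reasoning

  +-congˡ-% : ∀ {a b} c → a % n ≡ b % n → (c + a) % n ≡ (c + b) % n
  +-congˡ-% {a} {b} c a≈b =
    trans (cong (_% n) (+-comm c a)) (trans (+-congʳ-% c a≈b) (cong (_% n) (+-comm b c)))

  *-congˡ-% : ∀ {a b} c → a % n ≡ b % n → (c * a) % n ≡ (c * b) % n
  *-congˡ-% {a} {b} c a≈b = begin
    (c * a) % n             ≡⟨ %-distribˡ-* c a n ⟩
    (c % n * (a % n)) % n   ≡⟨ cong (λ x → (c % n * x) % n) a≈b ⟩
    (c % n * (b % n)) % n   ≡⟨ %-distribˡ-* c b n ⟨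
    (c * b) % n             ∎
    where open ≡-Reasoning

  shift-fixes⇒∣ : ∀ a c → (a + c) % n ≡ a % n → n ∣ c
  shift-fixes⇒∣ a c fixed = divides ((r + c) / n) (ℕ-+-cancelˡ-≡ r c _ (begin
    r + c                         ≡⟨ m≡m%n+[m/n]*n (r + c) n ⟩
    (r + c) % n + (r + c) / n * n ≡⟨ cong (_+ (r + c) / n * n) reduce ⟩
    r + (r + c) / n * n           ∎))
    where
    open ≡-Reasoning
    r : ℕ
    r = a % n
    reduce : (r + c) % n ≡ r
    reduce = trans (+-congʳ-% c (m%n%n≡m%n a n)) fixed

  toℕ-mod : ∀ a → toℕ (a mod n) ≡ a % n
  toℕ-mod a = toℕ-fromℕ< _

  mod-toℕ : ∀ (i : Fin n) → toℕ i mod n ≡ i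
  mod-toℕ i = toℕ-injective (trans (toℕ-mod (toℕ i)) (m<n⇒m%n≡m (toℕ<n i)))

  mod-cong : ∀ {a b} → a % n ≡ b % n → a mod n ≡ b mod n
  mod-cong {a} {b} a≈b = toℕ-injective (trans (toℕ-mod a) (trans a≈b (sym (toℕ-mod b))))

  mod-shift : ∀ a c → toℕ ((a + c) mod n) ≡ (toℕ (a mod n) + c) [mod n ]
  mod-shift a c rewrite toℕ-mod (a + c) | toℕ-mod a =
    subst (λ x → x ≡ (a % n + c) [mod n ]) (+-congʳ-% c (m%n%n≡m%n a n)) (%-≡mod (a % n + c))

even⇒double : ∀ d → parity d ≡ 0ℙ → ∃[ h ] d ≡ h * 2
even⇒double zero          _    = 0 , refl
even⇒double (suc (suc d)) even with even⇒double d even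
... | h , refl = suc h , refl

parity-+ : ∀ a c {p q} → parity a ≡ p → parity c ≡ q → parity (a + c) ≡ p ℙ.+ q
parity-+ a c refl refl = +-homo-+ a c

module _ {n : ℕ} .{{_ : NonZero n}} (n-even : parity n ≡ 0ℙ) where

  parity-% : ∀ a → parity (a % n) ≡ parity a
  parity-% a = sym (begin
    parity a                                   ≡⟨ cong parity (m≡m%n+[m/n]*n a n) ⟩
    parity (a % n + a / n * n)                 ≡⟨ +-homo-+ (a % n) (a / n * n) ⟩
    parity (a % n) ℙ.+ parity (a / n * n)      ≡⟨ cong (parity (a % n) ℙ.+_) multiple-even ⟩
    parity (a % n) ℙ.+ 0ℙ                      ≡⟨ ℙ-+-identityʳ (parity (a % n)) ⟩
    parity (a % n)                             ∎)
    where
    open ≡-Reasoning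
    multiple-even : parity (a / n * n) ≡ 0ℙ
    multiple-even = trans (*-homo-* (a / n) n)
                          (trans (cong (parity (a / n) ℙ.*_) n-even) (ℙ-*-zeroʳ (parity (a / n))))

  even-gap : ∀ {a b} → parity a ≡ parity b → ∃[ h ] (a + h * 2) % n ≡ b % n
  even-gap {a} {b} same with even⇒double (b + pred n * a) gap-even
    where
    gap-even : parity (b + pred n * a) ≡ 0ℙ
    gap-even = begin
      parity (b + pred n * a)                     ≡⟨ +-homo-+ b (pred n * a) ⟩
      parity b ℙ.+ parity (pred n * a)            ≡⟨ cong (parity b ℙ.+_) (*-homo-* (pred n) a) ⟩
      parity b ℙ.+ (parity (pred n) ℙ.* parity a) ≡⟨ cong (λ p → parity b ℙ.+ (p ℙ.* parity a)) pred-odd ⟩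
      parity b ℙ.+ parity a                       ≡⟨ cong (ℙ._+ parity a) (sym same) ⟩
      parity a ℙ.+ parity a                       ≡⟨ p+p≡0ℙ (parity a) ⟩
      0ℙ                                          ∎
      where
      open ≡-Reasoning
      pred-odd : parity (pred n) ≡ 1ℙ
      pred-odd = trans (sym (suc-homo-⁻¹ (pred n))) (cong _⁻¹ (trans (cong parity (suc-pred n)) n-even))
  ... | h , gap≡ = h , (begin
      (a + h * 2) % n              ≡⟨ cong (λ d → (a + d) % n) (sym gap≡) ⟩
      (a + (b + pred n * a)) % n   ≡⟨ cong (_% n) (rearrange a b (pred n)) ⟩
      (b + a * suc (pred n)) % n   ≡⟨ cong (λ m → (b + a * m) % n) (suc-pred n) ⟩
      (b + a * n) % n              ≡⟨ [m+kn]%n≡m%n b a n ⟩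
      b % n                        ∎)
    where
    open ≡-Reasoning
    rearrange : ∀ a b p → a + (b + p * a) ≡ b + a * suc p
    rearrange = solve-∀

-- Arithmetic input.  For k prime to 3, (k + 3)/2 ≡ 3/2 is invertible modulo k,
-- i.e. some multiple of k + 3 is congruent to 2 modulo 2k.

odd-parity : ∀ {k} → ¬ (2 ∣ k) → parity k ≡ 1ℙ
odd-parity {k} 2∤k with parity k in pk
... | 0ℙ = ⊥-elim (2∤k (divides (proj₁ (even⇒double k pk)) (proj₂ (even⇒double k pk))))
... | 1ℙ = refl

-- k = 3t + 1: m = 4t + 2;  k = 3t + 2: m = 2t + 2
two-inverse : ∀ k → ¬ (3 ∣ k) → ∃[ m ] (m * (k + 3)) ≡ 2 [mod (2 * k) ]
two-inverse k 3∤k with k divMod 3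
... | result t Fin.zero refl = ⊥-elim (3∤k (divides t refl))
... | result t (Fin.suc Fin.zero) refl = 4 * t + 2 , inj₂ (2 * t + 3 , identity t)
  where
  identity : ∀ t → 2 + (2 * t + 3) * (2 * (1 + t * 3)) ≡ (4 * t + 2) * (1 + t * 3 + 3)
  identity = solve-∀
... | result t (Fin.suc (Fin.suc Fin.zero)) refl = 2 * t + 2 , inj₂ (t + 2 , identity t)
  where
  identity : ∀ t → 2 + (t + 2) * (2 * (2 + t * 3)) ≡ (2 * t + 2) * (2 + t * 3 + 3)
  identity = solve-∀

-- If m·c ≡ 2 (mod 2k), then 2k ∣ q·c forces k ∣ q: multiplying by m turns
-- q·c into 2q.
halving-cancel : ∀ {k m c q} .{{_ : NonZero k}} →
                 (m * c) ≡ 2 [mod (2 * k) ] → 2 * k ∣ q * c → k ∣ q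
halving-cancel {k} {m} {c} {q} inverse 2k∣qc =
  *-cancelˡ-∣ 2 (subst (2 * k ∣_) (*-comm q 2) (m%n≡0⇒n∣m (q * 2) (2 * k) q2≡0))
  where
  instance
    2k≢0 : NonZero (2 * k)
    2k≢0 = m*n≢0 2 k
  open Residues (2 * k)
  open ≡-Reasoning
  q2≡0 : (q * 2) % (2 * k) ≡ 0
  q2≡0 = begin
    (q * 2) % (2 * k)        ≡⟨ *-congˡ-% q (sym (≡mod⇒% inverse)) ⟩
    (q * (m * c)) % (2 * k)  ≡⟨ cong (_% (2 * k)) (swap-factors q m c) ⟩
    (m * (q * c)) % (2 * k)  ≡⟨ n∣m⇒m%n≡0 _ (2 * k) (∣n⇒∣m*n m 2k∣qc) ⟩
    0                        ∎
    where
    swap-factors : ∀ q m c → q * (m * c) ≡ m * (q * c)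
    swap-factors = solve-∀

module TwoOrbits (k : ℕ) (k-odd : parity k ≡ 1ℙ)
                 (m : ℕ) (inverse : (m * (k + 3)) ≡ 2 [mod (2 * k) ]) where

  n : ℕ
  n = 2 * k

  instance
    k≢0 : NonZero k
    k≢0 = ≢-nonZero (λ k≡0 → 0ℙ≢1ℙ (trans (cong parity (sym k≡0)) k-odd))
      where
      0ℙ≢1ℙ : 0ℙ ≢ 1ℙ
      0ℙ≢1ℙ ()
    n≢0 : NonZero n
    n≢0 = m*n≢0 2 k

  open Residues n

  n-even : parity n ≡ 0ℙ
  n-even = *-homo-* 2 k

  G : Graph
  G = T₂ k 2 1

  V : Set
  V = TVertex k

  _~_ : V → V → Set
  _~_ = Adj G

  adj-≡ : ∀ {x x′ y y′} → x ≡ x′ → y ≡ y′ → x′ ~ y′ → x ~ y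
  adj-≡ x≡x′ y≡y′ = subst₂ _~_ (sym x≡x′) (sym y≡y′)

  vtx : Kind → ℕ → V
  vtx t a = t , a mod n

  vtx-toℕ : ∀ t i → vtx t (toℕ i) ≡ (t , i)
  vtx-toℕ t i = cong (t ,_) (mod-toℕ i)

  vtx-cong : ∀ {t a b} → a % n ≡ b % n → vtx t a ≡ vtx t b
  vtx-cong a≈b = cong (_ ,_) (mod-cong a≈b)

  vtx-injective : ∀ {t a b} → vtx t a ≡ vtx t b → a % n ≡ b % n
  vtx-injective {t} {a} {b} e =
    trans (sym (toℕ-mod a)) (trans (cong (λ x → toℕ (proj₂ x)) e) (toℕ-mod b))

  vtx-index : ∀ t {b} {j : Fin n} → toℕ j ≡ b [mod n ] → vtx t b ≡ (t , j)
  vtx-index t {j = j} j≡b = trans (vtx-cong (sym (≡mod⇒% j≡b))) (vtx-toℕ t j)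

  wrap : ∀ t a → vtx t (a + k + k) ≡ vtx t a
  wrap t a = vtx-cong (trans (cong (_% n) (around a k)) ([m+kn]%n≡m%n a 1 n))
    where
    around : ∀ a k → a + k + k ≡ a + 1 * (2 * k)
    around = solve-∀

  ww-edge : ∀ a → vtx w a ~ vtx w (a + k)
  ww-edge a = inj₁ (ww (mod-shift a k))

  uv-edge : ∀ a → vtx u a ~ vtx v a
  uv-edge a = inj₁ uv

  uw-edge : ∀ a → vtx u a ~ vtx w a
  uw-edge a = inj₁ uw

  uwr-edge : ∀ a → vtx u a ~ vtx w (a + 2)
  uwr-edge a = inj₁ (uwr (mod-shift a 2))

  vv-edge : ∀ a → vtx v a ~ vtx v (a + 1)
  vv-edge a = inj₁ (vv (mod-shift a 1))

  move : Kind → Parity → Kind × ℕ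
  move u 0ℙ = v , 1
  move u 1ℙ = w , k + 2
  move v 0ℙ = u , 1
  move v 1ℙ = w , 2
  move w 0ℙ = v , 0
  move w 1ℙ = u , k

  jump : Kind → Parity → ℕ → V
  jump t p a = vtx (proj₁ (move t p)) (a + proj₂ (move t p))

  σ : V → V
  σ (t , i) = jump t (parity (toℕ i)) (toℕ i)

  -- σ is well defined on positions modulo 2k, since 2k is even.
  σ-vtx : ∀ t a → σ (vtx t a) ≡ jump t (parity a) a
  σ-vtx t a = begin
    jump t (parity (toℕ (a mod n))) (toℕ (a mod n)) ≡⟨ cong (λ x → jump t (parity x) x) (toℕ-mod a) ⟩
    jump t (parity (a % n)) (a % n)                 ≡⟨ cong (λ p → jump t p (a % n)) (parity-% n-even a) ⟩
    jump t (parity a) (a % n)                       ≡⟨ vtx-cong (+-congʳ-% _ (m%n%n≡m%n a n)) ⟩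
    jump t (parity a) a                             ∎
    where open ≡-Reasoning

  σ-at : ∀ t a {p} → parity a ≡ p → σ (vtx t a) ≡ jump t p a
  σ-at t a refl = σ-vtx t a

  σ-edge : ∀ s a t b {p q} → parity a ≡ p → parity b ≡ q →
           jump s p a ~ jump t q b → σ (vtx s a) ~ σ (vtx t b)
  σ-edge s a t b pa pb = adj-≡ (σ-at s a pa) (σ-at t b pb)

  k+2-odd : parity (k + 2) ≡ 1ℙ
  k+2-odd = parity-+ k 2 k-odd refl

  reassoc : ∀ a b c → a + (b + c) ≡ a + c + b
  reassoc = solve-∀

  σ-ww : ∀ a → σ (vtx w a) ~ σ (vtx w (a + k))
  σ-ww a with parity a in pa
  ... | 0ℙ = σ-edge w a w (a + k) pa (parity-+ a k pa k-odd)
               (swap (adj-≡ (wrap u a) (cong (vtx v) (+-identityʳ a)) (uv-edge a)))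
  ... | 1ℙ = σ-edge w a w (a + k) pa (parity-+ a k pa k-odd)
               (adj-≡ refl (cong (vtx v) (+-identityʳ (a + k))) (uv-edge (a + k)))

  σ-uv : ∀ a → σ (vtx u a) ~ σ (vtx v a)
  σ-uv a with parity a in pa
  ... | 0ℙ = σ-edge u a v a pa pa (swap (uv-edge (a + 1)))
  ... | 1ℙ = σ-edge u a v a pa pa (swap (adj-≡ refl (cong (vtx w) (reassoc a k 2)) (ww-edge (a + 2))))

  σ-uw : ∀ a → σ (vtx u a) ~ σ (vtx w a)
  σ-uw a with parity a in pa
  ... | 0ℙ = σ-edge u a w a pa pa
               (swap (adj-≡ (cong (vtx v) (+-identityʳ a)) refl (vv-edge a)))
  ... | 1ℙ = σ-edge u a w a pa pa
               (swap (adj-≡ refl (cong (vtx w) (sym (+-assoc a k 2))) (uwr-edge (a + k))))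

  σ-uwr : ∀ a → σ (vtx u a) ~ σ (vtx w (a + 2))
  σ-uwr a with parity a in pa
  ... | 0ℙ = σ-edge u a w (a + 2) pa (parity-+ a 2 pa refl)
               (adj-≡ refl (cong (vtx v) (trans (+-identityʳ (a + 2)) (sym (+-assoc a 1 1))))
                      (vv-edge (a + 1)))
  ... | 1ℙ = σ-edge u a w (a + 2) pa (parity-+ a 2 pa refl)
               (swap (adj-≡ refl (cong (vtx w) (reassoc a k 2)) (uw-edge (a + 2 + k))))

  σ-vv : ∀ a → σ (vtx v a) ~ σ (vtx v (a + 1))
  σ-vv a with parity a in pa
  ... | 0ℙ = σ-edge v a v (a + 1) pa (parity-+ a 1 pa refl) (uwr-edge (a + 1))
  ... | 1ℙ = σ-edge v a v (a + 1) pa (parity-+ a 1 pa refl)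
               (swap (adj-≡ refl (cong (vtx w) (sym (+-assoc a 1 1))) (uw-edge (a + 1 + 1))))

  on-vertices : ∀ {x x′ y y′} → x ≡ x′ → y ≡ y′ → σ x ~ σ y → σ x′ ~ σ y′
  on-vertices = subst₂ (λ x y → σ x ~ σ y)

  σ-preserves-edge : ∀ {x y} → TEdge k 2 1 x y → σ x ~ σ y
  σ-preserves-edge (ww {i} j≡)  = on-vertices (vtx-toℕ w i) (vtx-index w j≡) (σ-ww (toℕ i))
  σ-preserves-edge (uv {i})     = on-vertices (vtx-toℕ u i) (vtx-toℕ v i) (σ-uv (toℕ i))
  σ-preserves-edge (uw {i})     = on-vertices (vtx-toℕ u i) (vtx-toℕ w i) (σ-uw (toℕ i))
  σ-preserves-edge (uwr {i} j≡) = on-vertices (vtx-toℕ u i) (vtx-index w j≡) (σ-uwr (toℕ i))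
  σ-preserves-edge (vv {i} j≡)  = on-vertices (vtx-toℕ v i) (vtx-index v j≡) (σ-vv (toℕ i))

  σ-preserves : ∀ {x y} → x ~ y → σ x ~ σ y
  σ-preserves (inj₁ e) = σ-preserves-edge e
  σ-preserves (inj₂ e) = swap (σ-preserves-edge e)

  σ³-via : ∀ x {y z r} → σ x ≡ y → σ y ≡ z → σ z ≡ r → σ (σ (σ x)) ≡ r
  σ³-via x x↦y y↦z z↦r = trans (cong (λ x → σ (σ x)) x↦y) (trans (cong σ y↦z) z↦r)

  -- The six routes, by starting kind and parity (kinds visited, shifts):
  --   u even: v +1, w +2, u +k      u odd: w +(k+2), v +0, u +1
  --   v even: u +1, w +(k+2), v +0  v odd: w +2, u +k, v +1
  --   w even: v +0, u +1, w +(k+2)  w odd: u +k, v +1, w +2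
  σ³-u : ∀ a → σ (σ (σ (vtx u a))) ≡ vtx u (a + (k + 3))
  σ³-u a with parity a in pa
  ... | 0ℙ = trans (σ³-via (vtx u a) (σ-at u a pa) (σ-at v (a + 1) p₁) (σ-at w (a + 1 + 2) p₂))
                   (cong (vtx u) (total a k))
    where p₁ : parity (a + 1) ≡ 1ℙ
          p₁ = parity-+ a 1 pa refl
          p₂ : parity (a + 1 + 2) ≡ 1ℙ
          p₂ = parity-+ (a + 1) 2 p₁ refl
          total : ∀ a k → a + 1 + 2 + k ≡ a + (k + 3)
          total = solve-∀
  ... | 1ℙ = trans (σ³-via (vtx u a) (σ-at u a pa) (σ-at w (a + (k + 2)) p₁) (σ-at v (a + (k + 2) + 0) p₂))
                   (cong (vtx u) (total a k))
    where p₁ : parity (a + (k + 2)) ≡ 0ℙ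
          p₁ = parity-+ a (k + 2) pa k+2-odd
          p₂ : parity (a + (k + 2) + 0) ≡ 0ℙ
          p₂ = parity-+ (a + (k + 2)) 0 p₁ refl
          total : ∀ a k → a + (k + 2) + 0 + 1 ≡ a + (k + 3)
          total = solve-∀

  σ³-v : ∀ a → σ (σ (σ (vtx v a))) ≡ vtx v (a + (k + 3))
  σ³-v a with parity a in pa
  ... | 0ℙ = trans (σ³-via (vtx v a) (σ-at v a pa) (σ-at u (a + 1) p₁) (σ-at w (a + 1 + (k + 2)) p₂))
                   (cong (vtx v) (total a k))
    where p₁ : parity (a + 1) ≡ 1ℙ
          p₁ = parity-+ a 1 pa refl
          p₂ : parity (a + 1 + (k + 2)) ≡ 0ℙ
          p₂ = parity-+ (a + 1) (k + 2) p₁ k+2-odd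
          total : ∀ a k → a + 1 + (k + 2) + 0 ≡ a + (k + 3)
          total = solve-∀
  ... | 1ℙ = trans (σ³-via (vtx v a) (σ-at v a pa) (σ-at w (a + 2) p₁) (σ-at u (a + 2 + k) p₂))
                   (cong (vtx v) (total a k))
    where p₁ : parity (a + 2) ≡ 1ℙ
          p₁ = parity-+ a 2 pa refl
          p₂ : parity (a + 2 + k) ≡ 0ℙ
          p₂ = parity-+ (a + 2) k p₁ k-odd
          total : ∀ a k → a + 2 + k + 1 ≡ a + (k + 3)
          total = solve-∀

  σ³-w : ∀ a → σ (σ (σ (vtx w a))) ≡ vtx w (a + (k + 3))
  σ³-w a with parity a in pa
  ... | 0ℙ = trans (σ³-via (vtx w a) (σ-at w a pa) (σ-at v (a + 0) p₁) (σ-at u (a + 0 + 1) p₂))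
                   (cong (vtx w) (total a k))
    where p₁ : parity (a + 0) ≡ 0ℙ
          p₁ = parity-+ a 0 pa refl
          p₂ : parity (a + 0 + 1) ≡ 1ℙ
          p₂ = parity-+ (a + 0) 1 p₁ refl
          total : ∀ a k → a + 0 + 1 + (k + 2) ≡ a + (k + 3)
          total = solve-∀
  ... | 1ℙ = trans (σ³-via (vtx w a) (σ-at w a pa) (σ-at u (a + k) p₁) (σ-at v (a + k + 1) p₂))
                   (cong (vtx w) (total a k))
    where p₁ : parity (a + k) ≡ 0ℙ
          p₁ = parity-+ a k pa k-odd
          p₂ : parity (a + k + 1) ≡ 1ℙ
          p₂ = parity-+ (a + k) 1 p₁ refl
          total : ∀ a k → a + k + 1 + 2 ≡ a + (k + 3)
          total = solve-∀

  σ³-vtx : ∀ t a → σ (σ (σ (vtx t a))) ≡ vtx t (a + (k + 3))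
  σ³-vtx u = σ³-u
  σ³-vtx v = σ³-v
  σ³-vtx w = σ³-w

  σ³-iterate : ∀ q t a → iterate σ (q * 3) (vtx t a) ≡ vtx t (a + q * (k + 3))
  σ³-iterate zero    t a = cong (vtx t) (sym (+-identityʳ a))
  σ³-iterate (suc q) t a = begin
    σ (σ (σ (iterate σ (q * 3) (vtx t a))))  ≡⟨ cong (λ x → σ (σ (σ x))) (σ³-iterate q t a) ⟩
    σ (σ (σ (vtx t (a + q * (k + 3)))))      ≡⟨ σ³-vtx t (a + q * (k + 3)) ⟩
    vtx t (a + q * (k + 3) + (k + 3))        ≡⟨ cong (vtx t) (regroup a q (k + 3)) ⟩
    vtx t (a + suc q * (k + 3))              ∎
    where
    open ≡-Reasoning
    regroup : ∀ a q c → a + q * c + c ≡ a + suc q * c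
    regroup = solve-∀

  σ³-iterate′ : ∀ q x → iterate σ (q * 3) x ≡ vtx (proj₁ x) (toℕ (proj₂ x) + q * (k + 3))
  σ³-iterate′ q (t , i) = trans (cong (iterate σ (q * 3)) (sym (vtx-toℕ t i))) (σ³-iterate q t (toℕ i))

  -- Since k + 3 is even, k·(k + 3) is a multiple of 2k: σ has period 3k.
  period : ∀ x → iterate σ (k * 3) x ≡ x
  period (t , i) with even⇒double (k + 3) (parity-+ k 3 k-odd refl)
  ... | h , k+3≡h2 = trans (σ³-iterate′ k (t , i)) (trans (vtx-cong once-around) (vtx-toℕ t i))
    where
    once-around : (toℕ i + k * (k + 3)) % n ≡ toℕ i % n
    once-around = trans (cong (λ c → (toℕ i + k * c) % n) k+3≡h2)
                   (trans (cong (λ c → (toℕ i + c) % n) (rotate k h)) ([m+kn]%n≡m%n (toℕ i) h n))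
      where
      rotate : ∀ k h → k * (h * 2) ≡ h * (2 * k)
      rotate = solve-∀

  instance
    3k≢0 : NonZero (k * 3)
    3k≢0 = m*n≢0 k 3

  automorphism : Automorphism G
  automorphism = periodic-automorphism {G} σ (pred (k * 3)) σ-preserves
    (λ x → subst (λ N → iterate σ N x ≡ x) (sym (suc-pred (k * 3))) (period x))

  -- The invariant separating the two orbits: the parity of the position,
  -- flipped on the kinds v and w.
  tag : Kind → Parity
  tag u = 0ℙ
  tag v = 1ℙ
  tag w = 1ℙ

  class : V → Parity
  class (t , i) = tag t ℙ.+ parity (toℕ i)

  class-vtx : ∀ t a → class (vtx t a) ≡ tag t ℙ.+ parity a
  class-vtx t a = cong (tag t ℙ.+_) (trans (cong parity (toℕ-mod a)) (parity-% n-even a))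

  move-balanced : ∀ t p →
                  tag (proj₁ (move t p)) ℙ.+ (p ℙ.+ parity (proj₂ (move t p))) ≡ tag t ℙ.+ p
  move-balanced u 0ℙ = refl
  move-balanced u 1ℙ = cong (λ q → 1ℙ ℙ.+ (1ℙ ℙ.+ q)) k+2-odd
  move-balanced v 0ℙ = refl
  move-balanced v 1ℙ = refl
  move-balanced w 0ℙ = refl
  move-balanced w 1ℙ = cong (λ q → 0ℙ ℙ.+ (1ℙ ℙ.+ q)) k-odd

  class-σ : ∀ x → class (σ x) ≡ class x
  class-σ (t , i) = begin
    class (vtx t′ (a + c))               ≡⟨ class-vtx t′ (a + c) ⟩
    tag t′ ℙ.+ parity (a + c)            ≡⟨ cong (tag t′ ℙ.+_) (parity-+ a c refl refl) ⟩
    tag t′ ℙ.+ (parity a ℙ.+ parity c)   ≡⟨ move-balanced t (parity a) ⟩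
    tag t ℙ.+ parity a                   ∎
    where
    open ≡-Reasoning
    a : ℕ
    a = toℕ i
    t′ : Kind
    t′ = proj₁ (move t (parity a))
    c : ℕ
    c = proj₂ (move t (parity a))

  orbit-class : ∀ {b x} → InOrbit σ b x → class x ≡ class b
  orbit-class {b} (j , refl) = iterate-invariant σ class class-σ j b

  a₀ b₀ : V
  a₀ = vtx u 0
  b₀ = vtx v 0

  separated : ¬ InOrbit σ a₀ b₀
  separated o with trans (sym (class-vtx v 0)) (trans (orbit-class o) (class-vtx u 0))
  ... | ()

  -- Along an orbit a vertex may be moved by any even amount: σ^(3m) moves by
  -- m(k + 3) ≡ 2.
  shift-in-orbit : ∀ {b t a} → InOrbit σ b (vtx t a) → ∀ h → InOrbit σ b (vtx t (a + h * 2))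
  shift-in-orbit {b} {t} {a} o h =
    subst (InOrbit σ b) (trans (σ³-iterate (h * m) t a) (vtx-cong by-two)) (orbit-closed o (h * m * 3))
    where
    by-two : (a + h * m * (k + 3)) % n ≡ (a + h * 2) % n
    by-two = +-congˡ-% a (trans (cong (_% n) (*-assoc h m (k + 3))) (*-congˡ-% h (≡mod⇒% inverse)))

  class-in-orbit : ∀ {b} → (∀ t → ∃[ a ] InOrbit σ b (vtx t a)) →
                   ∀ x → class x ≡ class b → InOrbit σ b x
  class-in-orbit {b} meets (t , j) same with meets t
  ... | a , o with even-gap {n} n-even {a} {toℕ j} (ℙ-+-cancelˡ-≡ (tag t) _ _ tags)
    where
    tags : tag t ℙ.+ parity a ≡ tag t ℙ.+ parity (toℕ j)
    tags = trans (sym (class-vtx t a)) (trans (orbit-class o) (sym same))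
  ... | h , a+2h≈j = subst (InOrbit σ b) (trans (vtx-cong a+2h≈j) (vtx-toℕ t j)) (shift-in-orbit o h)

  meets-a₀ : ∀ t → ∃[ a ] InOrbit σ a₀ (vtx t a)
  meets-a₀ u = 0 , 0 , refl
  meets-a₀ v = 1 , 1 , σ-vtx u 0
  meets-a₀ w = 3 , 2 , trans (cong σ (σ-vtx u 0)) (σ-vtx v 1)

  meets-b₀ : ∀ t → ∃[ a ] InOrbit σ b₀ (vtx t a)
  meets-b₀ u = 1 , 1 , σ-vtx v 0
  meets-b₀ v = 0 , 0 , refl
  meets-b₀ w = 1 + (k + 2) , 2 , trans (cong σ (σ-vtx v 0)) (σ-vtx u 1)

  cover : ∀ x → InOrbit σ a₀ x ⊎ InOrbit σ b₀ x
  cover x with class x in cx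
  ... | 0ℙ = inj₁ (class-in-orbit meets-a₀ x (trans cx (sym (class-vtx u 0))))
  ... | 1ℙ = inj₂ (class-in-orbit meets-b₀ x (trans cx (sym (class-vtx v 0))))

  -- σ always changes the kind, σ³ never does, hence neither does σ² keep it.
  move-changes-kind : ∀ t p → proj₁ (move t p) ≢ t
  move-changes-kind u 0ℙ ()
  move-changes-kind u 1ℙ ()
  move-changes-kind v 0ℙ ()
  move-changes-kind v 1ℙ ()
  move-changes-kind w 0ℙ ()
  move-changes-kind w 1ℙ ()

  σ-changes-kind : ∀ x → proj₁ (σ x) ≢ proj₁ x
  σ-changes-kind (t , i) = move-changes-kind t (parity (toℕ i))

  σ³-keeps-kind : ∀ q x → proj₁ (iterate σ (q * 3) x) ≡ proj₁ x
  σ³-keeps-kind q x = cong proj₁ (σ³-iterate′ q x)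

  σ²-changes-kind : ∀ x → proj₁ (σ (σ x)) ≢ proj₁ x
  σ²-changes-kind x same = σ-changes-kind (σ (σ x)) (trans (σ³-keeps-kind 1 x) (sym same))

  -- No vertex returns before 3k steps: after 3q + 1 or 3q + 2 steps its kind
  -- differs, and after 3q steps with 0 < q < k it is moved by q(k + 3), which
  -- is not a multiple of 2k.
  no-early-return : ∀ x j → 0 < j → j < k * 3 → iterate σ j x ≢ x
  no-early-return x j 0<j j<3k back with j divMod 3
  ... | result zero Fin.zero refl with 0<j
  ...   | ()
  no-early-return x j 0<j j<3k back | result (suc q) Fin.zero refl =
    <⇒≱ (*-cancelʳ-< 3 (suc q) k j<3k) (∣⇒≤ (halving-cancel {k} {m} inverse returns))
    where
    returns : n ∣ suc q * (k + 3)
    returns = shift-fixes⇒∣ (toℕ (proj₂ x)) _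
      (vtx-injective (trans (sym (σ³-iterate′ (suc q) x)) (trans back (sym (vtx-toℕ _ _)))))
  no-early-return x j 0<j j<3k back | result q (Fin.suc Fin.zero) refl =
    σ-changes-kind (iterate σ (q * 3) x) (trans (cong proj₁ back) (sym (σ³-keeps-kind q x)))
  no-early-return x j 0<j j<3k back | result q (Fin.suc (Fin.suc Fin.zero)) refl =
    σ²-changes-kind (iterate σ (q * 3) x) (trans (cong proj₁ back) (sym (σ³-keeps-kind q x)))

  orbit-size : ∀ x → OrbitSize σ x (k * 3)
  orbit-size x = >-nonZero⁻¹ (k * 3) , period x , no-early-return x

  -- Connectivity: the v-vertices form a cycle, and every u (resp. w) vertex is
  -- adjacent to the v (resp. u) vertex at the same position.
  v-cycle : ∀ a → Reach G (vtx v 0) (vtx v a)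
  v-cycle zero    = here
  v-cycle (suc a) = v-cycle a ++ʳ step (adj-≡ refl (cong (vtx v) (+-comm 1 a)) (vv-edge a)) here

  reach-vtx : ∀ t a → Reach G (vtx v 0) (vtx t a)
  reach-vtx u a = v-cycle a ++ʳ step (swap (uv-edge a)) here
  reach-vtx v a = v-cycle a
  reach-vtx w a = reach-vtx u a ++ʳ step (uw-edge a) here

  connected : Connected G
  connected = connected-from-root swap (vtx v 0)
    (λ (t , i) → subst (Reach G (vtx v 0)) (vtx-toℕ t i) (reach-vtx t (toℕ i)))

  bicirculant : Bicirculant G
  bicirculant = connected , automorphism , k * 3 , a₀ , b₀ , 1<3k
              , orbit-size a₀ , orbit-size b₀ , separated , cover
    where
    1<3k : 1 < k * 3
    1<3k = <-≤-trans (s≤s (s≤s z≤n)) (*-monoˡ-≤ 3 (>-nonZero⁻¹ k))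

lemma5p10 : (k : ℕ) → 9 ≤ k → ¬ (2 ∣ k) → ¬ (3 ∣ k) → Bicirculant (T₂ k 2 1)
lemma5p10 k _ 2∤k 3∤k with two-inverse k 3∤k
... | m , inverse = TwoOrbits.bicirculant k (odd-parity 2∤k) m inverse
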